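{- Let $T$ be an Erdős–Szekeres tableau, and let $M=\max\{x:(x,y)\in T\}$ and $m=\max\{y:(x,y)\in T\}$. Then the order poset $P(T)$ has height at least $M+m-1$.
   Context: For a sequence $A=(a_1,\dots,a_n)$ of distinct reals, $a_i^+$ (resp. $a_i^-$) is the length of the longest increasing (resp. decreasing) subsequence ending at $a_i$; the EST is $T(A)=((a_i^+,a_i^-))_{i\le n}$, regarded also as a set of points. A sequence $A$ is identified with the linear order $i<_A j$ iff $a_i<a_j$ on $[n]$; $[T]$ is the set of such orders with $T(A)=T$; the order poset $P(T)$ on $[n]$ has $i<_{P(T)}j$ iff $i<_A j$ for all $A\in[T]$. The height of a poset is the maximum number of elements of a chain. -}

module Defs where

open import Data.Nat using (ℕ; zero; suc; _≤_; _∸_; _+_) renaming (_<_ to _<ℕ_)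
open import Data.Fin using (Fin; fromℕ) renaming (_<_ to _<F_)
open import Data.Product using (Σ; ∃; _×_; proj₁; proj₂)
open import Relation.Binary.PropositionalEquality using (_≡_)
open import Function.Definitions using (Injective)

-- A sequence of n distinct numbers (distinct values; only the relative
-- order matters, so natural numbers stand in for reals).
Seq : ℕ → Set
Seq n = Σ (Fin n → ℕ) (λ a → Injective _≡_ _≡_ a)

IncSub : ∀ {n} → (Fin n → ℕ) → ℕ → Set
IncSub {n} a k = Σ (Fin k → Fin n) λ c →
  ∀ p q → p <F q → (c p <F c q) × (a (c p) <ℕ a (c q))

DecSub : ∀ {n} → (Fin n → ℕ) → ℕ → Set
DecSub {n} a k = Σ (Fin k → Fin n) λ c →
  ∀ p q → p <F q → (c p <F c q) × (a (c q) <ℕ a (c p))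

IncEndingAt : ∀ {n} → (Fin n → ℕ) → Fin n → ℕ → Set
IncEndingAt a i k = Σ (IncSub a (suc k)) λ s → proj₁ s (fromℕ k) ≡ i

DecEndingAt : ∀ {n} → (Fin n → ℕ) → Fin n → ℕ → Set
DecEndingAt a i k = Σ (DecSub a (suc k)) λ s → proj₁ s (fromℕ k) ≡ i

IsLongestInc : ∀ {n} → (Fin n → ℕ) → Fin n → ℕ → Set
IsLongestInc a i ℓ = Σ ℕ λ k → (suc k ≡ ℓ) × IncEndingAt a i k
                     × (∀ k' → IncEndingAt a i k' → suc k' ≤ ℓ)

IsLongestDec : ∀ {n} → (Fin n → ℕ) → Fin n → ℕ → Set
IsLongestDec a i ℓ = Σ ℕ λ k → (suc k ≡ ℓ) × DecEndingAt a i k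
                     × (∀ k' → DecEndingAt a i k' → suc k' ≤ ℓ)

Tableau : ℕ → Set
Tableau n = Fin n → ℕ × ℕ

HasEST : ∀ {n} → Seq n → Tableau n → Set
HasEST A T = ∀ i → IsLongestInc (proj₁ A) i (proj₁ (T i))
                 × IsLongestDec (proj₁ A) i (proj₂ (T i))

IsEST : ∀ {n} → Tableau n → Set
IsEST T = Σ (Seq _) λ A → HasEST A T

_<P[_]_ : ∀ {n} → Fin n → Tableau n → Fin n → Set
i <P[ T ] j = ∀ (A : Seq _) → HasEST A T → proj₁ A i <ℕ proj₁ A j

HasChain : ∀ {n} → Tableau n → ℕ → Set
HasChain {n} T h = Σ (Fin h → Fin n) λ c → ∀ p q → p <F q → c p <P[ T ] c q

HeightAtLeast : ∀ {n} → Tableau n → ℕ → Set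
HeightAtLeast T h = HasChain T h

IsMaxFst : ∀ {n} → Tableau n → ℕ → Set
IsMaxFst T M = (∃ λ i → proj₁ (T i) ≡ M) × (∀ i → proj₁ (T i) ≤ M)

IsMaxSnd : ∀ {n} → Tableau n → ℕ → Set
IsMaxSnd T m = (∃ λ i → proj₂ (T i) ≡ m) × (∀ i → proj₂ (T i) ≤ m)

-- Fix a sequence A realising T and write x i = a⁺_i, y i = a⁻_i.  For a
-- level k of x let W_k be the LAST position with x = k, and for a level l
-- of y let E_l be the last position with y = l; both are determined by T
-- alone.  Consecutive levels give chains W_1 <P … <P W_M and
-- E_m <P … <P E_1, and in A the value a(W_k) increases with k while a(E_l)
-- decreases with l.  Merge the two lists by their values in A: where a W
-- is followed by an E the two positions coincide, and where an E is
-- followed by a W the two are separated by a third position ρ with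
-- E <P ρ <P W.  Following the merged list yields a chain of P(T) with
-- M + m − 1 elements ending at E_1.
module Submission where

open import Defs
open import Data.Nat using (ℕ; _+_; _∸_)
open import Data.Nat using (zero; suc; _≤_; z≤n; s≤s; s≤s⁻¹) renaming (_<_ to _<ℕ_)
open import Data.Nat.Properties
  using (_≟_; _≤?_; _<?_; <⇒≱; ≮⇒≥; ≰⇒>; <⇒≤; 1+n≰n; ≤-refl; ≤-trans; ≤-reflexive;
         ≤-<-trans; ≤-antisym; <-trans; <-irrefl; m≤n⇒m<n∨m≡n; n≤1+n; m≤n+m; m∸n+n≡m;
         1+n≢n; suc-injective; +-suc; +-comm; +-identityʳ; <-isStrictTotalOrder)
open import Data.Fin using (Fin; toℕ; fromℕ; inject₁; inject≤)
  renaming (_<_ to _<F_; _≤_ to _≤F_)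
open import Data.Fin.Properties
  using (toℕ-fromℕ; toℕ-inject₁; toℕ-inject≤; inject₁ℕ<; ≤fromℕ; any?)
  renaming (<-cmp to <F-cmp; <-trans to <F-trans; <-irrefl to <F-irrefl; _<?_ to _<F?_)
open import Data.Fin.Relation.Unary.Top using (view; ‵fromℕ; ‵inject₁; view-fromℕ)
open import Data.Product using (Σ; ∃; _×_; _,_; proj₁; proj₂)
open import Data.Sum using (inj₁; inj₂)
open import Data.Empty using (⊥-elim)
open import Function using (_∘_)
open import Relation.Nullary using (¬_; Dec; yes; no)
open import Relation.Nullary.Decidable using (_×-dec_)
open import Relation.Binary.Definitions using (Transitive; tri<; tri≈; tri>)
open import Relation.Binary.Structures using (IsStrictTotalOrder)
open import Relation.Binary.Construct.Closure.Reflexive using (ReflClosure; refl; [_])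
import Relation.Binary.Construct.Flip.EqAndOrd as Flip
open import Relation.Binary.PropositionalEquality
  using (_≡_; refl; sym; trans; cong; subst; subst₂)

Increasing : ∀ {B : Set} {k} → (B → B → Set) → (Fin k → B) → Set
Increasing S c = ∀ p q → p <F q → S (c p) (c q)

-- An S-chain with suc h entries whose last entry is z.  For S the relation
-- "later and larger" this is Defs' subsequence ending at a position; for S
-- the order of P(T) it is a chain of P(T).
ChainTo : ∀ {B : Set} → (B → B → Set) → B → ℕ → Set
ChainTo {B} S z h = Σ (Σ (Fin (suc h) → B) (Increasing S)) λ s → proj₁ s (fromℕ h) ≡ z

inject₁<fromℕ : ∀ {h} (p : Fin h) → inject₁ p <F fromℕ h
inject₁<fromℕ {h} p = subst (toℕ (inject₁ p) <ℕ_) (sym (toℕ-fromℕ h)) (inject₁ℕ< p)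

fromℕ≮ : ∀ {h} (q : Fin (suc h)) → ¬ (fromℕ h <F q)
fromℕ≮ q lt = <⇒≱ lt (≤fromℕ q)

inject₁-mono : ∀ {h} {p q : Fin h} → p <F q → inject₁ p <F inject₁ q
inject₁-mono {p = p} {q} = subst₂ _<ℕ_ (sym (toℕ-inject₁ p)) (sym (toℕ-inject₁ q))

inject₁-mono⁻¹ : ∀ {h} {p q : Fin h} → inject₁ p <F inject₁ q → p <F q
inject₁-mono⁻¹ {p = p} {q} = subst₂ _<ℕ_ (toℕ-inject₁ p) (toℕ-inject₁ q)

_∷ʳ_ : ∀ {B : Set} {h} → (Fin h → B) → B → Fin (suc h) → B
(c ∷ʳ z) i with view i
... | ‵fromℕ = z
... | ‵inject₁ j = c j

∷ʳ-last : ∀ {B : Set} {h} (c : Fin h → B) z → (c ∷ʳ z) (fromℕ h) ≡ z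
∷ʳ-last {h = h} c z rewrite view-fromℕ h = refl

extend : ∀ {B : Set} {S : B → B → Set} {z z' h} →
         Transitive S → ChainTo S z h → S z z' → ChainTo S z' (suc h)
extend {S = S} {z' = z'} S-trans ((c , c↑) , refl) s = (c ∷ʳ z' , c∷z'↑) , ∷ʳ-last c z'
  where
    below-z' : ∀ p → S (c p) z'
    below-z' p with view p
    ... | ‵fromℕ = s
    ... | ‵inject₁ j = S-trans (c↑ _ _ (inject₁<fromℕ j)) s

    c∷z'↑ : Increasing S (c ∷ʳ z')
    c∷z'↑ p q p<q with view p | view q
    ... | ‵fromℕ | _ = ⊥-elim (fromℕ≮ q p<q)
    ... | ‵inject₁ i | ‵fromℕ = below-z' i
    ... | ‵inject₁ i | ‵inject₁ j = c↑ i j (inject₁-mono⁻¹ p<q)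

penultimate : ∀ {B : Set} {S : B → B → Set} {z h} →
              ChainTo S z (suc h) → Σ B λ z' → ChainTo S z' h × S z' z
penultimate {h = h} ((c , c↑) , refl) =
  c (inject₁ (fromℕ h)) ,
  ((c ∘ inject₁ , λ p q p<q → c↑ _ _ (inject₁-mono p<q)) , refl) ,
  c↑ _ _ (inject₁<fromℕ (fromℕ h))

prefix : ∀ {B : Set} {S : B → B → Set} {z h h'} →
         ChainTo S z h → h' ≤ suc h → Σ (Fin h' → B) (Increasing S)
prefix ((c , c↑) , _) h'≤ =
  (λ p → c (inject≤ p h'≤)) ,
  λ p q p<q → c↑ _ _ (subst₂ _<ℕ_ (sym (toℕ-inject≤ p h'≤)) (sym (toℕ-inject≤ q h'≤)) p<q)

lastWith : ∀ {n} {P : Fin n → Set} → (∀ i → Dec (P i)) → ∃ P →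
           Σ (Fin n) λ ρ → P ρ × (∀ i → P i → i ≤F ρ)
lastWith {suc n} P? (i , pi) with any? (P? ∘ Fin.suc)
... | yes later with lastWith (P? ∘ Fin.suc) later
...   | ρ , pρ , latest = Fin.suc ρ , pρ , λ { Fin.zero _ → z≤n ; (Fin.suc j) pj → s≤s (latest j pj) }
lastWith {suc n} {P} P? (i , pi) | no none = Fin.zero , at-zero i pi , λ
  { Fin.zero _ → z≤n ; (Fin.suc j) pj → ⊥-elim (none (j , pj)) }
  where
    at-zero : ∀ j → P j → P Fin.zero
    at-zero Fin.zero pj = pj
    at-zero (Fin.suc j) pj = ⊥-elim (none (j , pj))

R*-then-R : ∀ {B : Set} {R : B → B → Set} → Transitive R →
            ∀ {u v w} → ReflClosure R u v → R v w → R u w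
R*-then-R R-trans refl r = r
R*-then-R R-trans [ r ] s = R-trans r s

Step : ∀ {n} → (ℕ → ℕ → Set) → (Fin n → ℕ) → Fin n → Fin n → Set
Step R a u v = (u <F v) × R (a u) (a v)

-- ℓ is the length of a longest R-subsequence ending at position i
-- (for R = _<_ this is IsLongestInc, for R = flip _<_ it is IsLongestDec).
LongestAt : ∀ {n} → (ℕ → ℕ → Set) → (Fin n → ℕ) → Fin n → ℕ → Set
LongestAt R a i ℓ = Σ ℕ λ k → (suc k ≡ ℓ) × ChainTo (Step R a) i k
                    × (∀ k' → ChainTo (Step R a) i k' → suc k' ≤ ℓ)

module LongestFacts {n} {R : ℕ → ℕ → Set} (R-trans : Transitive R) (a : Fin n → ℕ)
                    (f : Fin n → ℕ) (f-longest : ∀ i → LongestAt R a i (f i)) where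

  Step-trans : Transitive (Step R a)
  Step-trans (u<v , r) (v<w , s) = <F-trans u<v v<w , R-trans r s

  positive : ∀ i → 1 ≤ f i
  positive i = subst (1 ≤_) (proj₁ (proj₂ (f-longest i))) (s≤s z≤n)

  -- An R-step strictly increases the length (extend the longest subsequence at i by j).
  longer : ∀ {i j} → Step R a i j → f i <ℕ f j
  longer {i} {j} s with f-longest i | f-longest j
  ... | k , fi , chain , _ | _ , _ , _ , maximal =
    subst (_<ℕ f j) fi (maximal (suc k) (extend Step-trans chain s))

  -- If f j ≥ 2, the penultimate entry of a longest subsequence at j is one level lower.
  predecessor : ∀ j → 2 ≤ f j → Σ (Fin n) λ i → Step R a i j × suc (f i) ≡ f j
  predecessor j 2≤fj with f-longest j
  ... | zero , f≡1 , _ = ⊥-elim (1+n≰n (subst (2 ≤_) (sym f≡1) 2≤fj))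
  ... | suc k , fj , chain , _ with penultimate chain
  ...   | i , chain-i , s = i , s , ≤-antisym (longer s) fj≤
    where
      fj≤ : f j ≤ suc (f i)
      fj≤ = subst (_≤ suc (f i)) fj (s≤s (proj₂ (proj₂ (proj₂ (f-longest i))) k chain-i))

  descend : ∀ d {k} j → 1 ≤ k → f j ≡ d + k →
            Σ (Fin n) λ i → (f i ≡ k) × ReflClosure R (a i) (a j)
  descend zero j _ fj = j , fj , refl
  descend (suc d) {k} j 1≤k fj with predecessor j (subst (2 ≤_) (sym fj) (s≤s (≤-trans 1≤k (m≤n+m k d))))
  ... | i' , (_ , r) , fi' with descend d i' 1≤k (suc-injective (trans fi' fj))
  ...   | i , fi , r* = i , fi , [ R*-then-R R-trans r* r ]

  reach : ∀ {k} j → 1 ≤ k → k ≤ f j → Σ (Fin n) λ i → (f i ≡ k) × ReflClosure R (a i) (a j)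
  reach {k} j 1≤k k≤fj = descend (f j ∸ k) j 1≤k (sym (m∸n+n≡m k≤fj))

-- f is x (with R = _<_) or y (with R = flip _<_).  The relation u ◁ v says
-- that a_u is R-below a_v in EVERY sequence realising T, so X's ◁ is the
-- order of P(T) and Y's ◁ is its reverse.

module Side {n} (T : Tableau n) {R : ℕ → ℕ → Set} (R-order : IsStrictTotalOrder _≡_ R)
            (f : Fin n → ℕ)
            (f-longest : ∀ {A : Seq n} → HasEST A T → ∀ i → LongestAt R (proj₁ A) i (f i)) where

  open IsStrictTotalOrder R-order using (compare) renaming (trans to R-trans; irrefl to R-irrefl)

  module In (A : Seq n) (hA : HasEST A T) = LongestFacts {R = R} R-trans (proj₁ A) f (f-longest {A} hA)

  _◁_ : Fin n → Fin n → Set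
  u ◁ v = ∀ (A : Seq n) → HasEST A T → R (proj₁ A u) (proj₁ A v)

  Last : ℕ → Fin n → Set
  Last k w = (f w ≡ k) × (∀ i → f i ≡ k → i ≤F w)

  -- A later position at a level no higher is R-below: an R-step would raise the level.
  later-lower : ∀ {i j} → i <F j → f j ≤ f i → j ◁ i
  later-lower {i} {j} i<j fj≤fi (a , a-inj) hA with compare (a i) (a j)
  ... | tri< r _ _ = ⊥-elim (<⇒≱ (In.longer (a , a-inj) hA (i<j , r)) fj≤fi)
  ... | tri≈ _ e _ = ⊥-elim (<F-irrefl (a-inj e) i<j)
  ... | tri> _ _ r = r

  -- The last position before j one level below j is ◁-below j: the predecessor
  -- of j in any realisation is either it or an earlier position of its level.
  last-predecessor : ∀ {j ρ} → ρ <F j → suc (f ρ) ≡ f j →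
                     (∀ i → i <F j → suc (f i) ≡ f j → i ≤F ρ) → ρ ◁ j
  last-predecessor {j} {ρ} ρ<j fρ latest A hA = from-predecessor (In.predecessor A hA j 2≤fj)
    where
      2≤fj : 2 ≤ f j
      2≤fj = subst (2 ≤_) fρ (s≤s (In.positive A hA ρ))

      from-predecessor : (Σ (Fin n) λ i → Step R (proj₁ A) i j × suc (f i) ≡ f j) →
                         R (proj₁ A ρ) (proj₁ A j)
      from-predecessor (i , (i<j , r) , fi) with <F-cmp i ρ
      ... | tri< i<ρ _ _ =
        R-trans (later-lower i<ρ (≤-reflexive (suc-injective (trans fρ (sym fi)))) A hA) r
      ... | tri≈ _ refl _ = r
      ... | tri> _ _ ρ<i = ⊥-elim (<⇒≱ ρ<i (latest i i<j fi))

  last-levels : ∀ {k u v} → Last k u → Last (suc k) v → u ◁ v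
  last-levels {k} {u} {v} (fu , u-last) (fv , _) with <F-cmp u v
  ... | tri< u<v _ _ =
    last-predecessor u<v (trans (cong suc fu) (sym fv)) (λ i _ fi → u-last i (suc-injective (trans fi fv)))
  ... | tri≈ _ refl _ = ⊥-elim (1+n≢n (trans (sym fv) fu))
  ... | tri> _ _ v<u = later-lower v<u (subst₂ _≤_ (sym fu) (sym fv) (n≤1+n k))

  module Realised (A : Seq n) (hA : HasEST A T) where
    open In A hA public using (positive; longer; predecessor; reach)

    a : Fin n → ℕ
    a = proj₁ A

    last-exists : ∀ {k} j → 1 ≤ k → k ≤ f j → Σ (Fin n) (Last k)
    last-exists {k} j 1≤k k≤fj =
      let (i , fi , _) = reach j 1≤k k≤fj in lastWith (λ i → f i ≟ k) (i , fi)

    level-below : ∀ {k w} → Last (suc (suc k)) w → Σ (Fin n) (Last (suc k))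
    level-below {k} {w} (fw , _) = last-exists w (s≤s z≤n) (subst (suc k ≤_) (sym fw) (n≤1+n (suc k)))

    last-least : ∀ {k w i} → Last k w → f i ≡ k → ReflClosure R (a w) (a i)
    last-least {w = w} {i} (fw , w-last) fi with <F-cmp i w
    ... | tri< i<w _ _ = [ later-lower i<w (≤-reflexive (trans fw (sym fi))) A hA ]
    ... | tri≈ _ refl _ = refl
    ... | tri> _ _ w<i = ⊥-elim (<⇒≱ w<i (w-last i fi))

    below-last : ∀ {k w i} → Last k w → R (a i) (a w) → f i <ℕ k
    below-last {k} {w} {i} lw r with f i <? k
    ... | yes fi<k = fi<k
    ... | no fi≮k with reach i (subst (1 ≤_) (proj₁ lw) (positive w)) (≮⇒≥ fi≮k)
    ...   | i' , fi' , r' =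
      ⊥-elim (R-irrefl refl (R*-then-R R-trans (last-least lw fi') (R*-then-R R-trans r' r)))

    immediate-predecessor : ∀ j → 2 ≤ f j → Σ (Fin n) λ ρ → (ρ <F j) × (suc (f ρ) ≡ f j) × (ρ ◁ j)
    immediate-predecessor j 2≤fj with predecessor j 2≤fj
    ... | i , (i<j , _) , fi with lastWith (λ i → (i <F? j) ×-dec (suc (f i) ≟ f j)) (i , i<j , fi)
    ...   | ρ , (ρ<j , fρ) , latest =
      ρ , ρ<j , fρ , last-predecessor ρ<j fρ (λ i i<j fi → latest i (i<j , fi))

    -- If e comes after the last position w of its level and a_e is R-below a_w,
    -- the immediate predecessor ρ of w separates them: e ◁ ρ ◁ w.
    separated : ∀ {k w e} → Last k w → w <F e → R (a e) (a w) → Σ (Fin n) λ ρ → (e ◁ ρ) × (ρ ◁ w)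
    separated {k} {w} {e} lw@(fw , _) w<e r =
      let (ρ , ρ<w , fρ , ρ◁w) = immediate-predecessor w 2≤fw
          fe≤fρ = s≤s⁻¹ (subst (f e <ℕ_) (trans (sym fw) (sym fρ)) fe<k)
      in  ρ , later-lower (<F-trans ρ<w w<e) fe≤fρ , ρ◁w
      where
        fe<k : f e <ℕ k
        fe<k = below-last lw r
        2≤fw : 2 ≤ f w
        2≤fw = subst (2 ≤_) (sym fw) (≤-trans (s≤s (positive e)) fe<k)

module Coordinates {n} (T : Tableau n) where
  x y : Fin n → ℕ
  x i = proj₁ (T i)
  y i = proj₂ (T i)

  module X = Side T <-isStrictTotalOrder x (λ hA i → proj₁ (hA i))
  module Y = Side T (Flip.isStrictTotalOrder <-isStrictTotalOrder) y (λ hA i → proj₂ (hA i))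

-- Fix a realisation A of T with maximal y-level suc m'.  Write W_k for
-- the last position of x-level k and E_l for that of y-level l.

module Merge {n} (T : Tableau n) (A : Seq n) (hA : HasEST A T)
             (m' : ℕ) (maxY : IsMaxSnd T (suc m')) where
  open Coordinates T
  module XA = X.Realised A hA
  module YA = Y.Realised A hA
  open XA using (a)

  _<P_ : Fin n → Fin n → Set
  u <P v = u <P[ T ] v

  E-exists : ∀ {l} → l ≤ m' → Σ (Fin n) (Y.Last (suc l))
  E-exists {l} l≤m' =
    let ((j , yj) , _) = maxY in YA.last-exists j (s≤s z≤n) (subst (suc l ≤_) (sym yj) (s≤s l≤m'))

  <P-trans : Transitive _<P_
  <P-trans u<v v<w B hB = <-trans (u<v B hB) (v<w B hB)

  x-chain : ∀ k {w} → X.Last (suc k) w → ChainTo _<P_ w k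
  x-chain zero {w} _ = ((λ _ → w) , λ { Fin.zero Fin.zero () }) , refl
  x-chain (suc k) lw =
    let (w' , lw') = XA.level-below lw in extend <P-trans (x-chain k lw') (X.last-levels lw' lw)

  -- If a_{W_k} ≤ a_{E_l}, neither can be strictly below the other without
  -- violating the level bounds, so they are the same position.
  coincide : ∀ {k l w e} → X.Last k w → Y.Last l e → a w ≤ a e → x e ≤ k → y w ≤ l → w ≡ e
  coincide {k} {l} {w} {e} (xw , _) (ye , _) aw≤ae xe≤k yw≤l with m≤n⇒m<n∨m≡n aw≤ae
  ... | inj₂ same = proj₂ A same
  ... | inj₁ aw<ae with <F-cmp w e
  ...   | tri< w<e _ _ = ⊥-elim (<⇒≱ (XA.longer (w<e , aw<ae)) (subst (x e ≤_) (sym xw) xe≤k))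
  ...   | tri≈ _ w≡e _ = w≡e
  ...   | tri> _ _ e<w = ⊥-elim (<⇒≱ (YA.longer (e<w , aw<ae)) (subst (y w ≤_) (sym ye) yw≤l))

  -- If a_{E_l} < a_{W_k}, some position lies strictly between them in P(T):
  -- use the immediate predecessor of whichever of the two comes later.
  between : ∀ {k l w e} → X.Last k w → Y.Last l e → a e <ℕ a w → Σ (Fin n) λ ρ → (e <P ρ) × (ρ <P w)
  between {w = w} {e} lw le ae<aw with <F-cmp w e
  ... | tri< w<e _ _ = XA.separated lw w<e ae<aw
  ... | tri≈ _ refl _ = ⊥-elim (<-irrefl refl ae<aw)
  ... | tri> _ _ e<w with YA.separated le e<w ae<aw
  ...   | ρ , w▷ρ , ρ▷e = ρ , ρ▷e , w▷ρ

  -- The two mutually recursive claims, for w = W_{suc k}, e = E_{suc l},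
  -- with d = m' − l further y-levels above l:
  -- • if a_w ≤ a_e and nothing of x-level beyond suc k is A-below e,
  --   there is a chain with suc (d + k) elements ending at e;
  -- • if a_e < a_w, there is one with suc (suc (d + k)) elements ending at w.
  -- Each claim steps to the next element of the merged list below.
  mutual
    chain-at-E : ∀ d {k l w e} → d + l ≡ m' → X.Last (suc k) w → Y.Last (suc l) e → a w ≤ a e →
                 (∀ i → a i ≤ a e → x i ≤ suc k) → ChainTo _<P_ e (d + k)
    chain-at-E zero {k} {w = w} {e} refl lw le aw≤ae below =
      subst (λ z → ChainTo _<P_ z k) (coincide lw le aw≤ae (below e ≤-refl) (proj₂ maxY w)) (x-chain k lw)
    chain-at-E (suc d) {k} {l} {w} {e} d+l≡ lw le aw≤ae below
      with E-exists (subst (suc l ≤_) d+l≡ (s≤s (m≤n+m l d)))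
    ... | e' , le' with a w ≤? a e'
    ...   | yes aw≤ae' = extend <P-trans (chain-at-E d (trans (+-suc d l) d+l≡) lw le' aw≤ae' below') e'<Pe
      where
        e'<Pe : e' <P e
        e'<Pe = Y.last-levels le le'
        below' : ∀ i → a i ≤ a e' → x i ≤ suc k
        below' i ai≤ = below i (≤-trans ai≤ (<⇒≤ (e'<Pe A hA)))
    ...   | no aw≰ae' = subst (λ z → ChainTo _<P_ z (suc (d + k))) w≡e
                          (chain-at-W d (trans (+-suc d l) d+l≡) lw le' ae'<aw)
      where
        ae'<aw : a e' <ℕ a w
        ae'<aw = ≰⇒> aw≰ae'
        w≡e : w ≡ e
        w≡e = coincide lw le aw≤ae (below e ≤-refl) (s≤s⁻¹ (YA.below-last le' ae'<aw))

    chain-at-W : ∀ d {k l w e} → d + l ≡ m' → X.Last (suc k) w → Y.Last (suc l) e → a e <ℕ a w →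
                 ChainTo _<P_ w (suc (d + k))
    chain-at-W d {zero} {e = e} _ lw le ae<aw = ⊥-elim (<⇒≱ (XA.below-last lw ae<aw) (XA.positive e))
    chain-at-W d {suc k} {l} {w} {e} d+l≡ lw le ae<aw rewrite +-suc d k with XA.level-below lw
    ... | w' , lw' with a w' ≤? a e
    ...   | yes aw'≤ae =
      let (ρ , e<Pρ , ρ<Pw) = between lw le ae<aw
      in  extend <P-trans (extend <P-trans (chain-at-E d d+l≡ lw' le aw'≤ae below) e<Pρ) ρ<Pw
      where
        below : ∀ i → a i ≤ a e → x i ≤ suc k
        below i ai≤ = s≤s⁻¹ (XA.below-last lw (≤-<-trans ai≤ ae<aw))
    ...   | no aw'≰ae = extend <P-trans (chain-at-W d d+l≡ lw' le (≰⇒> aw'≰ae)) (X.last-levels lw' lw)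

  -- Starting from W_{suc k} (the top x-level) and E_1.
  long-chain : ∀ {k} → IsMaxFst T (suc k) → HasChain T (k + suc m')
  long-chain {k} ((iM , xiM) , allM)
    with XA.last-exists iM (s≤s z≤n) (≤-reflexive (sym xiM)) | E-exists z≤n
  ... | w , lw | e , le =
    prefix {S = _<P_} (chain-at-E m' (+-identityʳ m') lw le aw≤ae (λ i _ → allM i)) length≤
    where
      -- a_e < a_w would put w below y-level 1.
      aw≤ae : a w ≤ a e
      aw≤ae = ≮⇒≥ (λ ae<aw → <⇒≱ (YA.below-last le ae<aw) (YA.positive w))
      length≤ : k + suc m' ≤ suc (m' + k)
      length≤ = ≤-reflexive (trans (+-suc k m') (cong suc (+-comm k m')))

-- The theorem.  Both maxima are positive, since every tableau entry is.

lemma8 : ∀ {n} (T : Tableau n) (M m : ℕ) → IsEST T → IsMaxFst T M → IsMaxSnd T m →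
         HeightAtLeast T (M + m ∸ 1)
lemma8 T zero m (A , hA) ((i , x≡0) , _) _ =
  ⊥-elim (1+n≰n (subst (1 ≤_) x≡0 (Coordinates.X.Realised.positive T A hA i)))
lemma8 T (suc k) zero (A , hA) _ ((i , y≡0) , _) =
  ⊥-elim (1+n≰n (subst (1 ≤_) y≡0 (Coordinates.Y.Realised.positive T A hA i)))
lemma8 T (suc k) (suc m') (A , hA) maxX maxY = Merge.long-chain T A hA m' maxY maxX
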